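{- Let $k\ge2$ and let $B=(1,b_2,\dots,b_k)$ be positive integers with $1<b_2<\cdots<b_k$ forming an orderly sequence; let $c=\max\{O_B(r)\mid 0\le r\le b_k-1\}$ and suppose $c\ge2$. Let $h,d$ be positive integers with $h\ge\left\lceil\frac{d}{c-1}\right\rceil$, and for positive integers $a$ with $\gcd(a,d)=1$ let $A(a)=(a,ha+d,ha+db_2,\dots,ha+db_k)$. Then there exist two sequences of nonnegative integers $W_B=(w_j)_{0\le j\le b_k-1}$ and $R_B=(r_j)_{0\le j\le b_k-1}$ such that for all $a\ge(c-1)b_k$ with $\gcd(a,d)=1$, $$g(A(a))=(w_jh-1)a+r_jd+(ha+b_kd)\left(\left\lfloor\frac{a}{b_k}\right\rfloor-c+1\right),\quad\text{where } a\equiv j\pmod{b_k}.$$ Moreover, $W_B$ and $R_B$ are both (weakly) increasing in $j$, and $w_{b_k-1}-w_0\le1$.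
   Context: For $M\in\mathbb{N}$, $O_B(M):=\min\{\sum_{i=1}^k x_i \mid \sum_{i=1}^k b_ix_i=M,\ x_i\in\mathbb{N}\}$ with $b_1=1$. Let $G_B(M)$ be the number of parts used by the greedy strategy (use as many copies of $b_k$ as possible, then of $b_{k-1}$, and so on). $B$ is orderly if $O_B(M)=G_B(M)$ for all $M\in\mathbb{N}$. The Frobenius number $g(a_1,\dots,a_n)$ of positive integers with $\gcd=1$ is the largest integer not representable as $\sum x_ia_i$ with $x_i\in\mathbb{N}$. -}

module Defs where

open import Data.Nat using (ℕ; zero; suc; _+_; _*_; _∸_; _≤_; _<_)
open import Data.Nat.DivMod using (_/_; _%_)
open import Data.Fin using (Fin; zero; suc; fromℕ; toℕ)
open import Data.Fin.Base as F using ()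
open import Data.Integer as ℤ using (ℤ; +_)
open import Data.Product using (Σ; ∃; _×_; _,_)
open import Data.List using (List; []; _∷_; reverse; tabulate)
open import Relation.Binary.PropositionalEquality using (_≡_)
open import Relation.Nullary using (¬_)

∑ : ∀ {n} → (Fin n → ℕ) → ℕ
∑ {zero} f = 0
∑ {suc n} f = f zero + ∑ (λ i → f (suc i))

-- floor division and remainder (divisor 0 gives 0 / the dividend; only used with positive divisors)
_div_ : ℕ → ℕ → ℕ
m div zero = 0
m div suc n = m / suc n

_mod_ : ℕ → ℕ → ℕ
m mod zero = m
m mod suc n = m % suc n

⌈_/_⌉ : ℕ → ℕ → ℕ
⌈ m / zero ⌉ = 0
⌈ m / suc n ⌉ = (m + n) / suc n

IsRep : ∀ {n} → (Fin n → ℕ) → (Fin n → ℕ) → ℕ → Set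
IsRep b x M = ∑ (λ i → b i * x i) ≡ M

Representable : ∀ {n} → (Fin n → ℕ) → ℕ → Set
Representable b M = ∃ λ x → IsRep b x M

IsOpt : ∀ {n} → (Fin n → ℕ) → ℕ → ℕ → Set
IsOpt b M o = (∃ λ x → IsRep b x M × ∑ x ≡ o)
            × (∀ x → IsRep b x M → o ≤ ∑ x)

-- greedy number of parts, denominations listed in decreasing order
greedyList : List ℕ → ℕ → ℕ
greedyList [] M = 0
greedyList (zero ∷ bs) M = greedyList bs M
greedyList (suc b ∷ bs) M = M / suc b + greedyList bs (M % suc b)

G : ∀ {n} → (Fin n → ℕ) → ℕ → ℕ
G b M = greedyList (reverse (tabulate b)) M

Orderly : ∀ {n} → (Fin n → ℕ) → Set
Orderly b = ∀ M → IsOpt b M (G b M)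

IsMaxOpt : ∀ {n} → (Fin n → ℕ) → ℕ → ℕ → Set
IsMaxOpt b bk c = (∃ λ r → r < bk × IsOpt b r c)
                × (∀ r o → r < bk → IsOpt b r o → o ≤ c)

IsFrobenius : ∀ {n} → (Fin n → ℕ) → ℤ → Set
IsFrobenius a F = (¬ (∃ λ m → F ≡ + m × Representable a m))
                × (∀ m → F ℤ.< + m → Representable a m)

Aseq : ∀ {k} → (Fin k → ℕ) → ℕ → ℕ → ℕ → Fin (suc k) → ℕ
Aseq b h d a zero = a
Aseq b h d a (suc i) = h * a + d * b i

-- Writing m = y a + ∑ (h a + d b_i) x_i, a sum with ∑ b_i x_i = t uses at least
-- O_B(t) = G_B(t) of the large generators, so the semigroup generated by A(a) is
-- { Φ t + y a } with Φ t = h a G_B(t) + d t.  As gcd(a, d) = 1 and Φ t ≡ d t (mod a),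
-- the t < a meet every residue class once; as G_B(t + b_k) = G_B(t) + 1 and G_B(r) ≤ c
-- for r < b_k, G_B does not decrease along steps of a ≥ (c - 1) b_k, so Φ is smallest
-- on [0, a) within each class and g(A(a)) = max_{t<a} Φ t - a.  For a = (b_k + j) + Q' b_k
-- the maximum sits at T = s + Q' b_k with s the last maximiser of G_B on [0, b_k + j)
-- (a unit of G_B is worth h a ≥ d b_k), which gives w_j = G_B(s) + c - 2 and
-- r_j = b_k (c - 2) + s.
module Submission where

open import Data.Nat using (ℕ; zero; suc; _+_; _*_; _∸_; _≤_; _<_; _≥_; z≤n; s≤s; _≤?_; _<?_; NonZero; >-nonZero⁻¹)
open import Data.Nat.Properties
open import Data.Nat.DivMod using (_/_; _%_; m≡m%n+[m/n]*n; m%n<n; m/n*n≤m; [m+n]%n≡m%n; m/n≡1+[m∸n]/n; /-monoˡ-≤; m*n/n≡m)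
open import Data.Nat.Divisibility using (_∣_; divides; ∣m+n∣m⇒∣n; n∣m*n; ∣⇒≤)
open import Data.Nat.Coprimality using (Coprime; coprime-divisor; coprime-Bézout)
open import Data.Nat.GCD using (module Bézout)
open import Data.Nat.Tactic.RingSolver using (solve-∀)
open import Data.Product using (Σ; ∃; ∃₂; _×_; _,_; proj₁; proj₂)
open import Data.Sum using (inj₁; inj₂)
open import Data.Empty using (⊥-elim)
open import Relation.Nullary using (¬_; yes; no)
open import Relation.Binary.PropositionalEquality
open import Data.Fin using (Fin; zero; suc; fromℕ) renaming (_<_ to _<ᶠ_)
open import Data.List using ([]; _∷_; reverse; tabulate; _∷ʳ_)
open import Data.List.Properties using (unfold-reverse)
open import Data.Integer as ℤ using (ℤ; +_)
import Data.Integer.Properties as ℤP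
import Data.Integer.Tactic.RingSolver as ℤ-Solver
open import Defs

-- Congruence modulo a, stated without subtraction.
infix 4 _≡_[mod_]
_≡_[mod_] : ℕ → ℕ → ℕ → Set
x ≡ y [mod a ] = ∃₂ λ k l → x + k * a ≡ y + l * a

≡[mod]⇒+* : ∀ {x m a} → x ≡ m [mod a ] → x < m + a → ∃ λ y → x + y * a ≡ m
≡[mod]⇒+* {x} {m} {a} (k , l , eq) x<m+a with ≤-total k l
... | inj₂ l≤k with m≤n⇒∃[o]m+o≡n l≤k
...   | e , refl = e , +-cancelʳ-≡ (l * a) _ _ (trans (shuffle x l e a) eq)
  where
  shuffle : ∀ x l e a → x + e * a + l * a ≡ x + (l + e) * a
  shuffle = solve-∀
≡[mod]⇒+* {x} {m} {a} (k , l , eq) x<m+a | inj₁ k≤l with m≤n⇒∃[o]m+o≡n k≤l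
... | e , refl = below e (+-cancelʳ-≡ (k * a) x _ (trans eq (shuffle m k e a)))
  where
  shuffle : ∀ m k e a → m + (k + e) * a ≡ m + e * a + k * a
  shuffle = solve-∀
  below : ∀ e → x ≡ m + e * a → ∃ λ y → x + y * a ≡ m
  below zero x≡m+0 = 0 , trans (+-identityʳ x) (trans x≡m+0 (+-identityʳ m))
  below (suc e′) x≡m+e*a = ⊥-elim (<⇒≱ x<m+a (begin
    m + a            ≤⟨ +-monoʳ-≤ m (m≤m+n a (e′ * a)) ⟩
    m + suc e′ * a   ≡⟨ x≡m+e*a ⟨
    x                ∎))
    where open ≤-Reasoning

coprime⇒solvable : ∀ {a d} .{{_ : NonZero a}} → Coprime a d → ∀ m → ∃ λ t → d * t ≡ m [mod a ]
coprime⇒solvable {suc a′} {d} cop m with coprime-Bézout cop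
... | Bézout.-+ x y 1+xa≡yd = y * m , 0 , x * m , (begin
      d * (y * m) + 0 * suc a′  ≡⟨ lhs d y m (suc a′) ⟩
      m * (y * d)               ≡⟨ cong (m *_) 1+xa≡yd ⟨
      m * (1 + x * suc a′)      ≡⟨ rhs m x (suc a′) ⟩
      m + x * m * suc a′        ∎)
  where
  open ≡-Reasoning
  lhs : ∀ d y m a → d * (y * m) + 0 * a ≡ m * (y * d)
  lhs = solve-∀
  rhs : ∀ m x a → m * (1 + x * a) ≡ m + x * m * a
  rhs = solve-∀
... | Bézout.+- x y 1+yd≡xa = y * m * a′ , m , m * a′ * x , (begin
      d * (y * m * a′) + m * suc a′  ≡⟨ lhs d y m a′ ⟩
      m + m * a′ * (1 + y * d)       ≡⟨ cong (λ z → m + m * a′ * z) 1+yd≡xa ⟩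
      m + m * a′ * (x * suc a′)      ≡⟨ rhs m a′ x ⟩
      m + m * a′ * x * suc a′        ∎)
  where
  open ≡-Reasoning
  lhs : ∀ d y m a′ → d * (y * m * a′) + m * suc a′ ≡ m + m * a′ * (1 + y * d)
  lhs = solve-∀
  rhs : ∀ m a′ x → m + m * a′ * (x * suc a′) ≡ m + m * a′ * x * suc a′
  rhs = solve-∀

coprime-∣-cancel : ∀ {a d e} → Coprime a d → ∀ X Y → X * a ≡ Y * a + d * e → a ∣ e
coprime-∣-cancel {a} cop X Y eq =
  coprime-divisor cop (∣m+n∣m⇒∣n (subst (a ∣_) eq (n∣m*n X)) (n∣m*n Y))

+-*-cancel : ∀ X Y d t e → X + d * t ≡ Y + d * (t + e) → X ≡ Y + d * e
+-*-cancel X Y d t e eq = +-cancelʳ-≡ (d * t) X (Y + d * e) (trans eq (shuffle Y d t e))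
  where
  shuffle : ∀ Y d t e → Y + d * (t + e) ≡ Y + d * e + d * t
  shuffle = solve-∀

module ShiftedFamily (a d : ℕ) .{{_ : NonZero a}} (κ : ℕ → ℕ) where

  Φ : ℕ → ℕ
  Φ t = κ t * a + d * t

  Φ+* : ∀ t y → Φ t + y * a ≡ (κ t + y) * a + d * t
  Φ+* t y = shuffle (κ t) a d t y
    where
    shuffle : ∀ k a d t y → k * a + d * t + y * a ≡ (k + y) * a + d * t
    shuffle = solve-∀

  Φ-gap : Coprime a d → ∀ {T} → T < a → (∀ k → Φ T ≤ Φ (T + k * a)) → ∀ t y → Φ t + suc y * a ≢ Φ T
  Φ-gap coprime {T} T<a mono t y eq with T ≤? t
  ... | yes T≤t with m≤n⇒∃[o]m+o≡n T≤t
  ...   | e , refl with coprime-∣-cancel coprime (κ T) (κ (T + e) + suc y)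
                        (+-*-cancel (κ T * a) _ d T e (trans (sym eq) (Φ+* (T + e) (suc y))))
  ...     | divides k refl = <-irrefl refl (begin-strict
            Φ T                          ≤⟨ mono k ⟩
            Φ (T + k * a)                <⟨ m<m+n _ (≤-trans (>-nonZero⁻¹ a) (m≤m+n a (y * a))) ⟩
            Φ (T + k * a) + suc y * a    ≡⟨ eq ⟩
            Φ T                          ∎)
    where open ≤-Reasoning
  Φ-gap coprime {T} T<a mono t y eq | no T≰t with m≤n⇒∃[o]m+o≡n (≰⇒> T≰t)
  ... | e , refl with coprime-∣-cancel coprime (κ t + suc y) (κ (suc t + e))
                     (+-*-cancel _ (κ (suc t + e) * a) d t (suc e)
                        (trans (sym (Φ+* t (suc y))) (trans eq (cong (λ z → κ (suc t + e) * a + d * z) (sym (+-suc t e))))))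
  ...   | a∣1+e = <⇒≱ T<a (begin
          a          ≤⟨ ∣⇒≤ a∣1+e ⟩
          suc e      ≤⟨ m≤n+m (suc e) t ⟩
          t + suc e  ≡⟨ +-suc t e ⟩
          T          ∎)
    where open ≤-Reasoning

  Φ-cover : Coprime a d → ∀ {T} → (∀ t → t < a → Φ t ≤ Φ T) → ∀ m → Φ T < m + a → ∃₂ λ t y → Φ t + y * a ≡ m
  Φ-cover coprime {T} max m ΦT<m+a with coprime⇒solvable coprime m
  ... | t , K , L , dt≡m = r , ≡[mod]⇒+* Φr≡m (≤-<-trans (max r (m%n<n t a)) ΦT<m+a)
    where
    open ≡-Reasoning
    r = t % a
    q = t / a
    Φr≡m : Φ r ≡ m [mod a ]
    Φr≡m = K + d * q , L + κ r , (begin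
      Φ r + (K + d * q) * a          ≡⟨ shuffle₁ (κ r) a d r q K ⟩
      κ r * a + (d * (r + q * a) + K * a) ≡⟨ cong (λ z → κ r * a + (d * z + K * a)) (m≡m%n+[m/n]*n t a) ⟨
      κ r * a + (d * t + K * a)      ≡⟨ cong (λ z → κ r * a + z) dt≡m ⟩
      κ r * a + (m + L * a)          ≡⟨ shuffle₂ (κ r) a m L ⟩
      m + (L + κ r) * a              ∎)
      where
      shuffle₁ : ∀ k a d r q K → k * a + d * r + (K + d * q) * a ≡ k * a + (d * (r + q * a) + K * a)
      shuffle₁ = solve-∀
      shuffle₂ : ∀ k a m L → k * a + (m + L * a) ≡ m + (L + k) * a
      shuffle₂ = solve-∀

module CountingFunction (bk : ℕ) .{{_ : NonZero bk}} (G : ℕ → ℕ)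
    (G-shift : ∀ t → G (t + bk) ≡ suc (G t)) (G-zero : G 0 ≡ 0) (G-pos : ∀ {t} → 0 < t → 0 < G t) where

  G-+* : ∀ t q → G (t + q * bk) ≡ q + G t
  G-+* t zero = cong G (+-identityʳ t)
  G-+* t (suc q) = begin
    G (t + (bk + q * bk))  ≡⟨ cong G (shuffle t bk (q * bk)) ⟩
    G (t + q * bk + bk)    ≡⟨ G-shift (t + q * bk) ⟩
    suc (G (t + q * bk))   ≡⟨ cong suc (G-+* t q) ⟩
    suc (q + G t)          ∎
    where
    open ≡-Reasoning
    shuffle : ∀ t b u → t + (b + u) ≡ t + u + b
    shuffle = solve-∀

  G-/% : ∀ t → G t ≡ t / bk + G (t % bk)
  G-/% t = trans (cong G (m≡m%n+[m/n]*n t bk)) (G-+* (t % bk) (t / bk))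

  G-lower : ∀ δ {t} → δ * bk < t → δ < G t
  G-lower zero = G-pos
  G-lower (suc δ) {t} lt with m≤n⇒∃[o]m+o≡n (≤-trans (m≤m+n bk (δ * bk)) (<⇒≤ lt))
  ... | u , refl = subst (suc δ <_) (sym (trans (cong G (+-comm bk u)) (G-shift u)))
                     (s≤s (G-lower δ (+-cancelˡ-< bk _ _ lt)))

  G-mono-far : ∀ δ → (∀ r → r < bk → G r ≤ suc δ) → ∀ {T t} → T + δ * bk ≤ t → G T ≤ G t
  G-mono-far δ bounded {T} {t} far = subst (_≤ G t) (sym (G-/% T)) (go (T % bk) (T / bk) (m%n<n T bk)
    (subst (λ z → z + δ * bk ≤ t) (m≡m%n+[m/n]*n T bk) far))
    where
    go : ∀ r q → r < bk → r + q * bk + δ * bk ≤ t → q + G r ≤ G t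
    go r q r<bk le with m≤n⇒∃[o]m+o≡n (≤-trans (m≤n+m (q * bk) r) (≤-trans (m≤m+n _ (δ * bk)) le))
    ... | u , refl = subst (q + G r ≤_) (sym (trans (cong G (+-comm (q * bk) u)) (G-+* u q)))
                       (+-monoʳ-≤ q (G-r≤G-u r r<bk r+δbk≤u))
      where
      r+δbk≤u : r + δ * bk ≤ u
      r+δbk≤u = +-cancelˡ-≤ (q * bk) _ _ (subst (_≤ q * bk + u) (shuffle r q δ bk) le)
        where
        shuffle : ∀ r q δ b → r + q * b + δ * b ≡ q * b + (r + δ * b)
        shuffle = solve-∀
      G-r≤G-u : ∀ r → r < bk → r + δ * bk ≤ u → G r ≤ G u
      G-r≤G-u zero _ _ = subst (_≤ G u) (sym G-zero) z≤n
      G-r≤G-u (suc r) r<bk le = ≤-trans (bounded (suc r) r<bk) (G-lower δ (≤-trans (s≤s (m≤n+m _ r)) le))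

  G-<2bk : ∀ {c t} → (∀ r → r < bk → G r ≤ c) → t < bk + bk → G t ≤ suc c
  G-<2bk {c} {t} bounded t<2bk with t <? bk
  ... | yes t<bk = m≤n⇒m≤1+n (bounded t t<bk)
  ... | no t≮bk with m≤n⇒∃[o]m+o≡n (≮⇒≥ t≮bk)
  ...   | u , refl = subst (_≤ suc c) (sym (trans (cong G (+-comm bk u)) (G-shift u)))
                       (s≤s (bounded u (+-cancelˡ-< bk _ _ t<2bk)))

-- The last maximiser of f on [0, L); junk value 0 when L = 0.
argmax : (ℕ → ℕ) → ℕ → ℕ
argmax f zero = 0
argmax f (suc L) with f (argmax f L) ≤? f L
... | yes _ = L
... | no _ = argmax f L

module _ (f : ℕ → ℕ) where

  argmax-< : ∀ L → argmax f (suc L) < suc L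
  argmax-< L with f (argmax f L) ≤? f L
  ... | yes _ = ≤-refl
  ... | no _ = s≤s (argmax-≤ L)
    where
    argmax-≤ : ∀ L → argmax f L ≤ L
    argmax-≤ zero = z≤n
    argmax-≤ (suc L) = <⇒≤ (argmax-< L)

  argmax-maximal : ∀ L s → s < L → f s ≤ f (argmax f L)
  argmax-maximal (suc L) s (s≤s s≤L) with f (argmax f L) ≤? f L | m≤n⇒m<n∨m≡n s≤L
  ... | yes _       | inj₂ refl = ≤-refl
  ... | yes am≤L    | inj₁ s<L  = ≤-trans (argmax-maximal L s s<L) am≤L
  ... | no am≰L     | inj₂ refl = <⇒≤ (≰⇒> am≰L)
  ... | no _        | inj₁ s<L  = argmax-maximal L s s<L

  argmax-last : ∀ L s → s < L → f (argmax f L) ≤ f s → s ≤ argmax f L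
  argmax-last (suc L) s (s≤s s≤L) with f (argmax f L) ≤? f L | m≤n⇒m<n∨m≡n s≤L
  ... | yes _       | _         = λ _ → s≤L
  ... | no am≰L     | inj₂ refl = λ am≤s → ⊥-elim (am≰L am≤s)
  ... | no _        | inj₁ s<L  = argmax-last L s s<L

  argmax-mono : ∀ L L′ → L ≤ L′ → argmax f (suc L) ≤ argmax f (suc L′)
  argmax-mono L L′ L≤L′ with f (argmax f (suc L′)) ≤? f (argmax f (suc L))
  ... | yes am′≤am = argmax-last (suc L′) _ (≤-trans (argmax-< L) (s≤s L≤L′)) am′≤am
  ... | no am′≰am = ≤-trans (<⇒≤ (argmax-< L)) (≮⇒≥ λ am′<1+L →
                      am′≰am (argmax-maximal (suc L) _ am′<1+L))

module Peak (bk′ c′ : ℕ) (G : ℕ → ℕ)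
    (G-shift : ∀ t → G (t + suc bk′) ≡ suc (G t)) (G-zero : G 0 ≡ 0) (G-pos : ∀ {t} → 0 < t → 0 < G t)
    (G-bounded : ∀ r → r < suc bk′ → G r ≤ suc (suc c′))
    (rmax : ℕ) (rmax<bk : rmax < suc bk′) (G-rmax : G rmax ≡ suc (suc c′)) where

  bk : ℕ
  bk = suc bk′

  open CountingFunction bk G G-shift G-zero G-pos

  peak : ℕ → ℕ
  peak j = argmax G (bk + j)

  peak< : ∀ j → peak j < bk + j
  peak< j = argmax-< G (bk′ + j)

  W R : ℕ → ℕ
  W j = G (peak j) + c′
  R j = bk * c′ + peak j

  W-mono : ∀ {i j} → i ≤ j → W i ≤ W j
  W-mono {i} {j} i≤j = +-monoˡ-≤ c′ (argmax-maximal G (bk + j) (peak i) (≤-trans (peak< i) (+-monoʳ-≤ bk i≤j)))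

  R-mono : ∀ {i j} → i ≤ j → R i ≤ R j
  R-mono {i} {j} i≤j = +-monoʳ-≤ (bk * c′) (argmax-mono G (bk′ + i) (bk′ + j) (+-monoʳ-≤ bk′ i≤j))

  W-last : W bk′ ≤ W 0 + 1
  W-last = begin
    G (peak bk′) + c′          ≤⟨ +-monoˡ-≤ c′ (G-<2bk G-bounded (≤-trans (peak< bk′) (+-monoʳ-≤ bk (n≤1+n bk′)))) ⟩
    suc (suc (suc c′)) + c′    ≤⟨ +-monoˡ-≤ c′ (s≤s c≤G-peak₀) ⟩
    suc (G (peak 0)) + c′      ≡⟨ +-comm 1 (W 0) ⟩
    W 0 + 1                    ∎
    where
    open ≤-Reasoning
    c≤G-peak₀ : suc (suc c′) ≤ G (peak 0)
    c≤G-peak₀ = subst (_≤ G (peak 0)) G-rmax (argmax-maximal G (bk + 0) rmax (≤-trans rmax<bk (m≤m+n bk 0)))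

  -- [Q′ * bk, a) is the window [0, bk + j) shifted by Q′ * bk; Φ attains its maximum on [0, a) there.
  module Window (h d a j Q′ : ℕ) (a≡ : a ≡ bk + j + Q′ * bk) (d*bk≤h*a : d * bk ≤ h * a) where

    instance
      a-nonZero : NonZero a
      a-nonZero = subst NonZero (sym a≡) _

    open ShiftedFamily a d (λ t → h * G t) public

    T : ℕ
    T = peak j + Q′ * bk

    T<a : T < a
    T<a = subst (T <_) (sym a≡) (+-monoˡ-< (Q′ * bk) (peak< j))

    Φ-+* : ∀ t q → Φ (t + q * bk) ≡ Φ t + q * (h * a + d * bk)
    Φ-+* t q = trans (cong (λ g → h * g * a + d * (t + q * bk)) (G-+* t q)) (shuffle h q (G t) a d t bk)
      where
      shuffle : ∀ h q g a d t b → h * (q + g) * a + d * (t + q * b) ≡ h * g * a + d * t + q * (h * a + d * b)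
      shuffle = solve-∀

    Φ-mono : ∀ {t u} → t ≤ u → G t ≤ G u → Φ t ≤ Φ u
    Φ-mono {t} {u} t≤u Gt≤Gu = +-mono-≤ (*-monoˡ-≤ a (*-monoʳ-≤ h Gt≤Gu)) (*-monoʳ-≤ d t≤u)

    j≤peak : j ≤ peak j
    j≤peak = ≮⇒≥ λ peak<j → 1+n≰n (begin
      suc (G (peak j))     ≡⟨ G-shift (peak j) ⟨
      G (peak j + bk)      ≤⟨ argmax-maximal G (bk + j) _ (subst (_< bk + j) (+-comm bk _) (+-monoʳ-< bk peak<j)) ⟩
      G (peak j)           ∎)
      where open ≤-Reasoning

    -- Raising G by one is worth h * a, which pays for moving up to bk to the right.
    Φ-window : ∀ s → s < bk + j → Φ s ≤ Φ (peak j)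
    Φ-window s s<bk+j with G s <? G (peak j)
    ... | no Gs≮Gp = Φ-mono (argmax-last G (bk + j) s s<bk+j (≮⇒≥ Gs≮Gp)) (argmax-maximal G (bk + j) s s<bk+j)
    ... | yes Gs<Gp = begin
      h * G s * a + d * s               ≤⟨ +-monoʳ-≤ (h * G s * a) (*-monoʳ-≤ d (≤-trans (<⇒≤ s<bk+j) (+-monoʳ-≤ bk j≤peak))) ⟩
      h * G s * a + d * (bk + p)        ≡⟨ shuffle₁ h (G s) a d bk p ⟩
      h * G s * a + d * bk + d * p      ≤⟨ +-monoˡ-≤ (d * p) (+-monoʳ-≤ (h * G s * a) d*bk≤h*a) ⟩
      h * G s * a + h * a + d * p       ≡⟨ shuffle₂ h (G s) a (d * p) ⟩
      h * suc (G s) * a + d * p         ≤⟨ +-monoˡ-≤ (d * p) (*-monoˡ-≤ a (*-monoʳ-≤ h Gs<Gp)) ⟩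
      h * G p * a + d * p               ∎
      where
      open ≤-Reasoning
      p = peak j
      shuffle₁ : ∀ h g a d b p → h * g * a + d * (b + p) ≡ h * g * a + d * b + d * p
      shuffle₁ = solve-∀
      shuffle₂ : ∀ h g a e → h * g * a + h * a + e ≡ h * suc g * a + e
      shuffle₂ = solve-∀

    window-decomposition : ∀ {t} → t < a → ∃₂ λ s q → s < bk + j × q ≤ Q′ × t ≡ s + q * bk
    window-decomposition {t} t<a with Q′ * bk ≤? t
    ... | yes Q′bk≤t = t ∸ Q′ * bk , Q′ , s<bk+j , ≤-refl , sym (m∸n+n≡m Q′bk≤t)
      where
      s<bk+j : t ∸ Q′ * bk < bk + j
      s<bk+j = +-cancelʳ-< (Q′ * bk) _ _ (subst₂ _<_ (sym (m∸n+n≡m Q′bk≤t)) a≡ t<a)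
    ... | no Q′bk≰t = t % bk , t / bk , ≤-trans (m%n<n t bk) (m≤m+n bk j) ,
                      <⇒≤ (*-cancelʳ-< bk _ _ (≤-<-trans (m/n*n≤m t bk) (≰⇒> Q′bk≰t))) ,
                      m≡m%n+[m/n]*n t bk

    Φ-max : ∀ t → t < a → Φ t ≤ Φ T
    Φ-max t t<a with window-decomposition t<a
    ... | s , q , s<bk+j , q≤Q′ , refl = begin
      Φ (s + q * bk)                        ≡⟨ Φ-+* s q ⟩
      Φ s + q * (h * a + d * bk)            ≤⟨ +-mono-≤ (Φ-window s s<bk+j) (*-monoˡ-≤ _ q≤Q′) ⟩
      Φ (peak j) + Q′ * (h * a + d * bk)    ≡⟨ Φ-+* (peak j) Q′ ⟨
      Φ T                                   ∎
      where open ≤-Reasoning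

    Φ-residue-mono : suc c′ * bk ≤ a → ∀ k → Φ T ≤ Φ (T + k * a)
    Φ-residue-mono far zero = ≤-reflexive (cong Φ (sym (+-identityʳ T)))
    Φ-residue-mono far (suc k) = Φ-mono (m≤m+n T _)
      (G-mono-far (suc c′) G-bounded (+-monoʳ-≤ T (≤-trans far (m≤m+n a (k * a)))))

    Φ-T≡WR : ∀ e → Q′ ≡ c′ + e → W j * h * a + R j * d + (h * a + bk * d) * e ≡ Φ T
    Φ-T≡WR e Q′≡ = begin
      W j * h * a + R j * d + (h * a + bk * d) * e  ≡⟨ shuffle (G p) c′ h a bk p d e ⟩
      Φ p + (c′ + e) * (h * a + d * bk)             ≡⟨ cong (λ q → Φ p + q * (h * a + d * bk)) Q′≡ ⟨
      Φ p + Q′ * (h * a + d * bk)                   ≡⟨ Φ-+* p Q′ ⟨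
      Φ T                                           ∎
      where
      open ≡-Reasoning
      p = peak j
      shuffle : ∀ g c h a b p d e →
        (g + c) * h * a + (b * c + p) * d + (h * a + b * d) * e ≡ h * g * a + d * p + (c + e) * (h * a + d * b)
      shuffle = solve-∀

m≤⌈m/n⌉*n : ∀ m n → m ≤ ⌈ m / suc n ⌉ * suc n
m≤⌈m/n⌉*n m n = +-cancelʳ-≤ n m _ (begin
  m + n                                       ≡⟨ m≡m%n+[m/n]*n (m + n) (suc n) ⟩
  (m + n) % suc n + ⌈ m / suc n ⌉ * suc n     ≤⟨ +-monoˡ-≤ _ (<⇒≤pred (m%n<n (m + n) (suc n))) ⟩
  n + ⌈ m / suc n ⌉ * suc n                   ≡⟨ +-comm n _ ⟩
  ⌈ m / suc n ⌉ * suc n + n                   ∎)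
  where open ≤-Reasoning

reverse-tabulate : ∀ {A : Set} m (f : Fin (suc m) → A) → ∃ λ rest → reverse (tabulate f) ≡ f (fromℕ m) ∷ rest
reverse-tabulate zero f = [] , refl
reverse-tabulate (suc m) f with reverse-tabulate m (λ i → f (suc i))
... | rest , eq = rest ∷ʳ f zero ,
  trans (unfold-reverse (f zero) (tabulate (λ i → f (suc i)))) (cong (_∷ʳ f zero) eq)

greedyList-zero : ∀ bs → greedyList bs 0 ≡ 0
greedyList-zero [] = refl
greedyList-zero (zero ∷ bs) = greedyList-zero bs
greedyList-zero (suc b ∷ bs) = greedyList-zero bs

greedyList-shift : ∀ b bs t → greedyList (suc b ∷ bs) (t + suc b) ≡ suc (greedyList (suc b ∷ bs) t)
greedyList-shift b bs t = cong₂ _+_ quotient (cong (greedyList bs) ([m+n]%n≡m%n t (suc b)))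
  where
  quotient : (t + suc b) / suc b ≡ suc (t / suc b)
  quotient = trans (m/n≡1+[m∸n]/n (m≤n+m (suc b) t)) (cong (λ u → suc (u / suc b)) (m+n∸n≡m t (suc b)))

∑-zero : ∀ {k} (b x : Fin k → ℕ) → ∑ x ≡ 0 → ∑ (λ i → b i * x i) ≡ 0
∑-zero {zero} b x _ = refl
∑-zero {suc k} b x ∑x≡0 = cong₂ _+_
  (trans (cong (λ z → b zero * z) (m+n≡0⇒m≡0 (x zero) ∑x≡0)) (*-zeroʳ (b zero)))
  (∑-zero (λ i → b (suc i)) (λ i → x (suc i)) (m+n≡0⇒n≡0 (x zero) ∑x≡0))

∑-linear : ∀ {k} (u v : ℕ) (b x : Fin k → ℕ) → ∑ (λ i → (u + v * b i) * x i) ≡ u * ∑ x + v * ∑ (λ i → b i * x i)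
∑-linear {zero} u v b x = shuffle u v
  where
  shuffle : ∀ u v → 0 ≡ u * 0 + v * 0
  shuffle = solve-∀
∑-linear {suc k} u v b x =
  trans (cong (λ z → (u + v * b zero) * x zero + z) (∑-linear u v (λ i → b (suc i)) (λ i → x (suc i))))
        (shuffle u v (b zero) (x zero) _ _)
  where
  shuffle : ∀ u v b x S T → (u + v * b) * x + (u * S + v * T) ≡ u * (x + S) + v * (b * x + T)
  shuffle = solve-∀

IsOpt-unique : ∀ {k} (b : Fin k → ℕ) {M o o′} → IsOpt b M o → IsOpt b M o′ → o ≡ o′
IsOpt-unique b ((x , rep , ∑x≡o) , o-min) ((x′ , rep′ , ∑x′≡o′) , o′-min) =
  ≤-antisym (subst (_ ≤_) ∑x′≡o′ (o-min x′ rep′)) (subst (_ ≤_) ∑x≡o (o′-min x rep))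

module _ {k} (b : Fin k → ℕ) (orderly : Orderly b) where

  G-pos : ∀ {t} → 0 < t → 0 < G b t
  G-pos {t} 0<t with orderly t
  ... | (x , rep , ∑x≡G) , _ = n≢0⇒n>0 λ G≡0 →
    <⇒≢ 0<t (trans (sym (∑-zero b x (trans ∑x≡G G≡0))) rep)

  representable⇒family : ∀ h d a {m} → Representable (Aseq b h d a) m →
                         ∃₂ λ t y → h * G b t * a + d * t + y * a ≡ m
  representable⇒family h d a {m} (ys , rep) with m≤n⇒∃[o]m+o≡n (proj₂ (orderly _) (λ i → ys (suc i)) refl)
  ... | δ , G+δ≡∑x = t , ys zero + h * δ , (begin
    h * G b t * a + d * t + (ys zero + h * δ) * a  ≡⟨ shuffle h (G b t) a d t (ys zero) δ ⟩
    a * ys zero + (h * a * (G b t + δ) + d * t)    ≡⟨ cong (λ S → a * ys zero + (h * a * S + d * t)) G+δ≡∑x ⟩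
    a * ys zero + (h * a * ∑ x + d * t)            ≡⟨ cong (λ z → a * ys zero + z) (∑-linear (h * a) d b x) ⟨
    ∑ (λ i → Aseq b h d a i * ys i)                ≡⟨ rep ⟩
    m                                              ∎)
    where
    open ≡-Reasoning
    x : Fin k → ℕ
    x i = ys (suc i)
    t : ℕ
    t = ∑ (λ i → b i * x i)
    shuffle : ∀ h g a d t y δ → h * g * a + d * t + (y + h * δ) * a ≡ a * y + (h * a * (g + δ) + d * t)
    shuffle = solve-∀

  family⇒representable : ∀ h d a {m} t y → h * G b t * a + d * t + y * a ≡ m → Representable (Aseq b h d a) m
  family⇒representable h d a {m} t y eq with orderly t
  ... | (x , rep , ∑x≡G) , _ = ys , (begin
    a * y + ∑ (λ i → (h * a + d * b i) * x i)         ≡⟨ cong (λ z → a * y + z) (∑-linear (h * a) d b x) ⟩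
    a * y + (h * a * ∑ x + d * ∑ (λ i → b i * x i))   ≡⟨ cong₂ (λ S u → a * y + (h * a * S + d * u)) ∑x≡G rep ⟩
    a * y + (h * a * G b t + d * t)                   ≡⟨ shuffle h (G b t) a d t y ⟩
    h * G b t * a + d * t + y * a                     ≡⟨ eq ⟩
    m                                                 ∎)
    where
    open ≡-Reasoning
    ys : Fin (suc k) → ℕ
    ys zero = y
    ys (suc i) = x i
    shuffle : ∀ h g a d t y → a * y + (h * a * g + d * t) ≡ h * g * a + d * t + y * a
    shuffle = solve-∀

isFrobenius-shift : ∀ {k} (A : Fin k → ℕ) (P a : ℕ) →
  (∀ m → P ≡ m + a → ¬ Representable A m) → (∀ m → P < m + a → Representable A m) →
  IsFrobenius A (+ P ℤ.- + a)
isFrobenius-shift A P a gap cover =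
  (λ (m , P-a≡m , rep) → gap m (ℤP.+-injective (begin
    + P                   ≡⟨ sub-add (+ P) (+ a) ⟩
    (+ P ℤ.- + a) ℤ.+ + a ≡⟨ cong (ℤ._+ + a) P-a≡m ⟩
    + m ℤ.+ + a           ≡⟨ ℤP.pos-+ m a ⟨
    + (m + a)             ∎)) rep) ,
  λ m P-a<m → cover m (lower (subst (ℤ._< + m ℤ.+ + a) (sym (sub-add (+ P) (+ a))) (ℤP.+-monoˡ-< (+ a) P-a<m)))
  where
  open ≡-Reasoning
  sub-add : ∀ (x y : ℤ) → x ≡ (x ℤ.- y) ℤ.+ y
  sub-add = ℤ-Solver.solve-∀
  lower : ∀ {m} → + P ℤ.< + m ℤ.+ + a → P < m + a
  lower {m} (ℤ.+<+ P<m+a) = subst (P <_) (ℤP.+-injective (sym (ℤP.pos-+ m a))) P<m+a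

ℤ-formula : ∀ x y z a c′ e →
  (+ x ℤ.- + 1) ℤ.* + a ℤ.+ + y ℤ.+ + z ℤ.* (+ suc (c′ + e) ℤ.- + suc (suc c′) ℤ.+ + 1)
  ≡ + (x * a + y + z * e) ℤ.- + a
ℤ-formula x y z a c′ e = begin
  (+ x ℤ.- + 1) ℤ.* + a ℤ.+ + y ℤ.+ + z ℤ.* (+ suc (c′ + e) ℤ.- + suc (suc c′) ℤ.+ + 1)
    ≡⟨ cong₂ (λ u v → (+ x ℤ.- + 1) ℤ.* + a ℤ.+ + y ℤ.+ + z ℤ.* (u ℤ.- v ℤ.+ + 1))
             (trans (ℤP.pos-+ 1 (c′ + e)) (cong (λ u → + 1 ℤ.+ u) (ℤP.pos-+ c′ e))) (ℤP.pos-+ 1 (suc c′)) ⟩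
  (+ x ℤ.- + 1) ℤ.* + a ℤ.+ + y ℤ.+ + z ℤ.* ((+ 1 ℤ.+ (+ c′ ℤ.+ + e)) ℤ.- (+ 1 ℤ.+ + suc c′) ℤ.+ + 1)
    ≡⟨ identity (+ x) (+ y) (+ z) (+ a) (+ c′) (+ e) ⟩
  (+ x ℤ.* + a ℤ.+ + y ℤ.+ + z ℤ.* + e) ℤ.- + a
    ≡⟨ cong (λ u → u ℤ.- + a) (cong₂ ℤ._+_ (cong₂ ℤ._+_ (ℤP.pos-* x a) refl) (ℤP.pos-* z e)) ⟨
  (+ (x * a) ℤ.+ + y ℤ.+ + (z * e)) ℤ.- + a
    ≡⟨ cong (λ u → u ℤ.- + a) (trans (cong (λ u → u ℤ.+ + (z * e)) (ℤP.pos-+ (x * a) y)) (ℤP.pos-+ (x * a + y) (z * e))) ⟨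
  + (x * a + y + z * e) ℤ.- + a ∎
  where
  open ≡-Reasoning
  identity : ∀ (x y z a c e : ℤ) →
    (x ℤ.- + 1) ℤ.* a ℤ.+ y ℤ.+ z ℤ.* ((+ 1 ℤ.+ (c ℤ.+ e)) ℤ.- (+ 1 ℤ.+ (+ 1 ℤ.+ c)) ℤ.+ + 1)
    ≡ (x ℤ.* a ℤ.+ y ℤ.+ z ℤ.* e) ℤ.- a
  identity = ℤ-Solver.solve-∀

module OrderlyFrobenius {n} (b : Fin (suc (suc n)) → ℕ) (orderly : Orderly b)
    (bk′ c′ : ℕ) (last≡ : b (fromℕ (suc n)) ≡ suc bk′) (max : IsMaxOpt b (suc bk′) (suc (suc c′))) where

  G-shift : ∀ t → G b (t + suc bk′) ≡ suc (G b t)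
  G-shift t with reverse-tabulate (suc n) b
  ... | rest , rev≡ rewrite rev≡ | last≡ = greedyList-shift bk′ rest t

  G-bounded : ∀ r → r < suc bk′ → G b r ≤ suc (suc c′)
  G-bounded r r<bk = proj₂ max r (G b r) r<bk (orderly r)

  open Peak bk′ c′ (G b) G-shift (greedyList-zero (reverse (tabulate b))) (G-pos b orderly) G-bounded
    (proj₁ (proj₁ max)) (proj₁ (proj₂ (proj₁ max)))
    (IsOpt-unique b (orderly _) (proj₂ (proj₂ (proj₁ max)))) public

  frobenius : ∀ h d → d ≤ h * suc c′ → ∀ a → a ≥ suc c′ * bk → Coprime a d →
    IsFrobenius (Aseq b h d a)
      ((+ (W (a mod bk) * h) ℤ.- + 1) ℤ.* + a
        ℤ.+ + (R (a mod bk) * d)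
        ℤ.+ + (h * a + bk * d) ℤ.* (+ (a div bk) ℤ.- + suc (suc c′) ℤ.+ + 1))
  frobenius h d d≤hc a far coprime with m≤n⇒∃[o]m+o≡n (c≤a/bk far)
    where
    c≤a/bk : a ≥ suc c′ * bk → suc c′ ≤ a / bk
    c≤a/bk far = subst (_≤ a / bk) (m*n/n≡m (suc c′) bk) (/-monoˡ-≤ bk far)
  ... | e , a/bk≡ = subst (IsFrobenius (Aseq b h d a)) (sym formula≡)
      (isFrobenius-shift (Aseq b h d a) (Φ T) a gap cover)
    where
    j = a % bk
    Q′ = c′ + e

    a≡ : a ≡ bk + j + Q′ * bk
    a≡ = trans (m≡m%n+[m/n]*n a bk) (trans (cong (λ q → j + q * bk) (sym a/bk≡)) (shuffle j Q′ bk))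
      where
      shuffle : ∀ j q b → j + suc q * b ≡ b + j + q * b
      shuffle = solve-∀

    d*bk≤h*a : d * bk ≤ h * a
    d*bk≤h*a = begin
      d * bk              ≤⟨ *-monoˡ-≤ bk d≤hc ⟩
      h * suc c′ * bk     ≡⟨ *-assoc h (suc c′) bk ⟩
      h * (suc c′ * bk)   ≤⟨ *-monoʳ-≤ h far ⟩
      h * a               ∎
      where open ≤-Reasoning

    open Window h d a j Q′ a≡ d*bk≤h*a

    formula≡ : (+ (W j * h) ℤ.- + 1) ℤ.* + a ℤ.+ + (R j * d)
                 ℤ.+ + (h * a + bk * d) ℤ.* (+ (a / bk) ℤ.- + suc (suc c′) ℤ.+ + 1)
               ≡ + Φ T ℤ.- + a
    formula≡ = begin
      (+ (W j * h) ℤ.- + 1) ℤ.* + a ℤ.+ + (R j * d) ℤ.+ + (h * a + bk * d) ℤ.* (+ (a / bk) ℤ.- + suc (suc c′) ℤ.+ + 1)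
        ≡⟨ cong (λ q → (+ (W j * h) ℤ.- + 1) ℤ.* + a ℤ.+ + (R j * d) ℤ.+ + (h * a + bk * d) ℤ.* (+ q ℤ.- + suc (suc c′) ℤ.+ + 1)) a/bk≡ ⟨
      (+ (W j * h) ℤ.- + 1) ℤ.* + a ℤ.+ + (R j * d) ℤ.+ + (h * a + bk * d) ℤ.* (+ suc (c′ + e) ℤ.- + suc (suc c′) ℤ.+ + 1)
        ≡⟨ ℤ-formula (W j * h) (R j * d) (h * a + bk * d) a c′ e ⟩
      + (W j * h * a + R j * d + (h * a + bk * d) * e) ℤ.- + a
        ≡⟨ cong (λ u → + u ℤ.- + a) (Φ-T≡WR e refl) ⟩
      + Φ T ℤ.- + a ∎
      where open ≡-Reasoning

    gap : ∀ m → Φ T ≡ m + a → ¬ Representable (Aseq b h d a) m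
    gap m ΦT≡m+a rep with representable⇒family b orderly h d a rep
    ... | t , y , Φt+ya≡m = Φ-gap coprime T<a (Φ-residue-mono far) t y
      (trans (shuffle (Φ t) y a) (trans (cong (_+ a) Φt+ya≡m) (sym ΦT≡m+a)))
      where
      shuffle : ∀ p y a → p + suc y * a ≡ p + y * a + a
      shuffle = solve-∀

    cover : ∀ m → Φ T < m + a → Representable (Aseq b h d a) m
    cover m ΦT<m+a = from-family (Φ-cover coprime {T} Φ-max m ΦT<m+a)
      where
      from-family : (∃₂ λ t y → Φ t + y * a ≡ m) → Representable (Aseq b h d a) m
      from-family (t , y , Φt+ya≡m) = family⇒representable b orderly h d a t y Φt+ya≡m

theorem4p3 : (n : ℕ) (b : Fin (suc (suc n)) → ℕ) →
    b zero ≡ 1 →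
    (∀ i j → i <ᶠ j → b i < b j) →
    Orderly b →
    (c : ℕ) → IsMaxOpt b (b (fromℕ (suc n))) c → c ≥ 2 →
    (h d : ℕ) → h ≥ 1 → d ≥ 1 → h ≥ ⌈ d / (c ∸ 1) ⌉ →
    let bk = b (fromℕ (suc n)) in
    Σ (ℕ → ℕ) λ W → Σ (ℕ → ℕ) λ R →
      (∀ a → a ≥ (c ∸ 1) * bk → Coprime a d →
        IsFrobenius (Aseq b h d a)
          ((+ (W (a mod bk) * h) ℤ.- + 1) ℤ.* + a
            ℤ.+ + (R (a mod bk) * d)
            ℤ.+ + (h * a + bk * d) ℤ.* (+ (a div bk) ℤ.- + c ℤ.+ + 1)))
      × (∀ i j → i ≤ j → j < bk → W i ≤ W j)
      × (∀ i j → i ≤ j → j < bk → R i ≤ R j)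
      × W (bk ∸ 1) ≤ W 0 + 1
theorem4p3 n b b₀≡1 increasing orderly (suc (suc c′)) max (s≤s (s≤s z≤n)) h d _ _ h≥⌈d/c-1⌉
  with b (fromℕ (suc n)) in last≡
... | zero = ⊥-elim (n≮0 (subst₂ _<_ b₀≡1 last≡ (increasing zero (fromℕ (suc n)) (s≤s z≤n))))
... | suc bk′ = W , R , frobenius h d d≤hc , (λ _ _ i≤j _ → W-mono i≤j) , (λ _ _ i≤j _ → R-mono i≤j) , W-last
  where
  open OrderlyFrobenius b orderly bk′ c′ last≡ max
  d≤hc : d ≤ h * suc c′
  d≤hc = ≤-trans (m≤⌈m/n⌉*n d c′) (*-monoˡ-≤ (suc c′) h≥⌈d/c-1⌉)
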